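{- For every $A\in\mathrm{Avoid}(m,F(1,2,2,1))$ with more than $m+1$ columns, every procedure graph of $A$ contains no directed cycle.
   Context: A $(0,1)$-matrix is simple if it has no repeated columns; $\|A\|$ is its number of columns. $\mathrm{Avoid}(m,F)$ is the set of $m$-rowed simple matrices not containing $F$ as a configuration (a row and column permutation of a submatrix). $F(1,2,2,1)$ is the $2\times 6$ matrix with one column $(0,0)^T$, two columns $(1,0)^T$, two columns $(0,1)^T$, one column $(1,1)^T$. Procedure graph: let $A\in\mathrm{Avoid}(m,F(1,2,2,1))$ with $n>m+1$ columns. Set $A_0=A$, $E_0=\emptyset$. For $i\ge0$, while $\|A_i\|>m+1$: there are two rows $j,k$ on which $A_i$ contains all four columns $(0,0)^T,(0,1)^T,(1,0)^T,(1,1)^T$, and one of the patterns ($0$ in row $j$, $1$ in row $k$) or ($1$ in row $j$, $0$ in row $k$) occurs in exactly one column $\alpha$ of $A_i$. Choose such $j,k$ and such a pattern, let $A_{i+1}$ be $A_i$ with $\alpha$ deleted, and $E_{i+1}=E_i\cup\{(x,y)\}$ where $x\in\{j,k\}$ is the row with entry $0$ in $\alpha$ and $y$ the row with entry $1$. After $n-m-1$ steps the directed graph on vertex set $[m]$ with edge set $E=E_{n-m-1}$ is a procedure graph of $A$ (choices are arbitrary). -}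

module Defs where

open import Data.Bool using (Bool; true; false)
open import Data.Nat using (ℕ; zero; suc; _≤_; _<_)
open import Data.Fin using (Fin; punchIn)
open import Data.Vec using (Vec; []; _∷_; lookup)
open import Data.Product using (_×_; _,_; ∃; ∃-syntax)
open import Data.List using (List; []; _∷_)
open import Data.List.Membership.Propositional using (_∈_)
open import Relation.Binary.PropositionalEquality using (_≡_)
open import Relation.Binary.Construct.Closure.Transitive using (TransClosure)
open import Relation.Nullary using (¬_)
open import Function.Definitions using (Injective)

Mat : ℕ → ℕ → Set
Mat m n = Fin m → Fin n → Bool

Simple : ∀ {m n} → Mat m n → Set
Simple {m} {n} A = ∀ (c c′ : Fin n) → (∀ (r : Fin m) → A r c ≡ A r c′) → c ≡ c′

-- A contains F as a configuration: some row and column permutation of a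
-- submatrix of A equals F, i.e. there are injective row/column maps.
Contains : ∀ {m n k l} → Mat m n → Mat k l → Set
Contains {m} {n} {k} {l} A F =
  ∃[ ρ ] ∃[ σ ] (Injective _≡_ _≡_ ρ × Injective _≡_ _≡_ σ ×
    (∀ (i : Fin k) (j : Fin l) → A (ρ i) (σ j) ≡ F i j))

-- F(1,2,2,1): columns (0,0), (1,0), (1,0), (0,1), (0,1), (1,1).
F1221 : Mat 2 6
F1221 i j = lookup (lookup rows i) j
  where
  rows : Vec (Vec Bool 6) 2
  rows = (false ∷ true ∷ true ∷ false ∷ false ∷ true ∷ [])
       ∷ (false ∷ false ∷ false ∷ true ∷ true ∷ true ∷ [])
       ∷ []

InAvoid : ∀ {m n} → Mat m n → Set
InAvoid A = Simple A × ¬ Contains A F1221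

deleteCol : ∀ {m n} → Fin (suc n) → Mat m (suc n) → Mat m n
deleteCol α A r c = A r (punchIn α c)

HasCol : ∀ {m n} → Mat m n → Fin m → Fin m → Bool → Bool → Set
HasCol A x y a b = ∃[ c ] (A x c ≡ a × A y c ≡ b)

-- One step of the procedure: A contains all four columns on rows x,y,
-- and α is the unique column with 0 in row x and 1 in row y.
-- (x is the row with 0 in α, y the row with 1; the edge added is (x , y).
--  Taking {j,k} = {x,y} in either order covers both patterns.)
IsStep : ∀ {m n} → Mat m n → Fin n → Fin m → Fin m → Set
IsStep A α x y =
  HasCol A x y false false × HasCol A x y false true ×
  HasCol A x y true false × HasCol A x y true true ×
  A x α ≡ false × A y α ≡ true ×
  (∀ c → A x c ≡ false → A y c ≡ true → c ≡ α)

Edge : ℕ → Set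
Edge m = Fin m × Fin m

data Run {m : ℕ} : {n : ℕ} → Mat m n → List (Edge m) → Set where
  stop : ∀ {n} {A : Mat m n} → n ≤ suc m → Run A []
  step : ∀ {n} {A : Mat m (suc n)} {α : Fin (suc n)} {x y : Fin m}
           {E : List (Edge m)} →
         suc m < suc n → IsStep A α x y →
         Run (deleteCol α A) E → Run A ((x , y) ∷ E)

ProcedureGraph : ∀ {m n} → Mat m n → List (Edge m) → Set
ProcedureGraph A E = Run A E

EdgeRel : ∀ {m} → List (Edge m) → Fin m → Fin m → Set
EdgeRel E a b = (a , b) ∈ E

Acyclic : ∀ {m} → List (Edge m) → Set
Acyclic {m} E = ∀ (v : Fin m) → ¬ TransClosure (EdgeRel E) v v

{-# OPTIONS --safe #-}
-- When the edge (x , y) is added, the deleted column α was the only one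
-- reading 0 in row x and 1 in row y, so from then on row y ⊆ row x (as sets
-- of 1-positions), and column deletions preserve this.  At that moment a
-- column reading 1 in row x and 0 in row y is still present, so row x ⊈ row y;
-- hence x is not reachable from y along earlier edges, each of which records a
-- row inclusion.  Therefore no edge closes a cycle with the edges before it.
module Submission where

open import Defs
open import Data.Nat using (ℕ; suc; _<_)
open import Data.Bool using (true; false)
open import Data.Empty using (⊥-elim)
open import Data.Fin using (Fin; punchIn)
open import Data.Fin.Properties using (punchInᵢ≢i)
open import Data.Product using (_×_; _,_; uncurry)
open import Data.Sum using (_⊎_; inj₁; inj₂)
open import Data.List using (List; []; _∷_; _++_)
open import Data.List.Properties using (++-identityʳ)
open import Data.List.Relation.Unary.All as All using (All; []; _∷_)
open import Data.List.Relation.Unary.Any using (here; there)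
open import Data.List.Relation.Binary.Subset.Propositional using (_⊆_)
open import Data.List.Relation.Binary.Permutation.Propositional.Properties
  using (∈-resp-↭; shift)
open import Function using (_∘_; Equivalence)
open import Relation.Binary.PropositionalEquality using (_≡_; refl; sym; trans; subst)
open import Relation.Binary.Construct.Closure.Transitive as Plus
  using (TransClosure; [_]; _∷_)
open import Relation.Binary.Construct.Closure.ReflexiveTransitive
  using (Star; ε; _◅_; _◅◅_; fold)
open import Relation.Nullary using (¬_)

module _ {m : ℕ} where

  TransClosure⇒Star : ∀ {R : Fin m → Fin m → Set} {a b} →
    TransClosure R a b → Star R a b
  TransClosure⇒Star [ r ]    = r ◅ ε
  TransClosure⇒Star (r ∷ rs) = r ◅ TransClosure⇒Star rs

  acyclic-[] : Acyclic {m} []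
  acyclic-[] v [ () ]
  acyclic-[] v (() ∷ _)

  acyclic-anti-⊆ : ∀ {E F : List (Edge m)} → F ⊆ E → Acyclic E → Acyclic F
  acyclic-anti-⊆ F⊆E acyclic v cycle =
    acyclic v (to Plus.equivalent (Plus.map F⊆E (from Plus.equivalent cycle)))
    where open Equivalence

  split-walk : ∀ {E : List (Edge m)} {x y a b} →
    TransClosure (EdgeRel ((x , y) ∷ E)) a b →
    TransClosure (EdgeRel E) a b ⊎ (Star (EdgeRel E) a x × Star (EdgeRel E) y b)
  split-walk [ here refl ] = inj₂ (ε , ε)
  split-walk [ there e ]   = inj₁ [ e ]
  split-walk (here refl ∷ w) with split-walk w
  ... | inj₁ w′         = inj₂ (ε , TransClosure⇒Star w′)
  ... | inj₂ (_ , y→b) = inj₂ (ε , y→b)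
  split-walk (there e ∷ w) with split-walk w
  ... | inj₁ w′           = inj₁ (e ∷ w′)
  ... | inj₂ (c→x , y→b) = inj₂ (e ◅ c→x , y→b)

  acyclic-∷ : ∀ {E : List (Edge m)} {x y} →
    Acyclic E → ¬ Star (EdgeRel E) y x → Acyclic ((x , y) ∷ E)
  acyclic-∷ acyclic y↛x v cycle with split-walk cycle
  ... | inj₁ cycle′        = acyclic v cycle′
  ... | inj₂ (v→x , y→v) = y↛x (y→v ◅◅ v→x)

  Dominates : ∀ {n} → Mat m n → Fin m → Fin m → Set
  Dominates B a b = ∀ c → B b c ≡ true → B a c ≡ true

  Dominates-deleteCol : ∀ {n} {B : Mat m (suc n)} {a b} (α : Fin (suc n)) →
    Dominates B a b → Dominates (deleteCol α B) a b
  Dominates-deleteCol α dominates = dominates ∘ punchIn α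

  Star⇒Dominates : ∀ {n} {B : Mat m n} {R : List (Edge m)} →
    All (uncurry (Dominates B)) R →
    ∀ {a b} → Star (EdgeRel R) a b → Dominates B a b
  Star⇒Dominates {B = B} dominated =
    fold (Dominates B) (λ e d c → All.lookup dominated e c ∘ d c) (λ _ t → t)

  module _ {n : ℕ} (B : Mat m (suc n)) (α : Fin (suc n)) (x y : Fin m) where

    step-dominates : IsStep B α x y → Dominates (deleteCol α B) x y
    step-dominates (_ , _ , _ , _ , _ , _ , α-unique) c yc≡1
      with B x (punchIn α c) in xc≡
    ... | true  = refl
    ... | false = ⊥-elim (punchInᵢ≢i α c (α-unique (punchIn α c) xc≡ yc≡1))

    step-¬dominates : IsStep B α x y → ¬ Dominates B y x
    step-¬dominates (_ , _ , (γ , xγ≡1 , yγ≡0) , _) dominates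
      with () ← trans (sym yγ≡0) (dominates γ xγ≡1)

  run-acyclic : ∀ {n} {B : Mat m n} {E R : List (Edge m)} → Run B E →
    All (uncurry (Dominates B)) R → Acyclic R → Acyclic (R ++ E)
  run-acyclic {R = R} (stop _) _ acyclic = subst Acyclic (sym (++-identityʳ R)) acyclic
  run-acyclic {B = B} {R = R} (step {α = α} {x} {y} {E} _ isStep run) dominated acyclic =
    acyclic-anti-⊆ (∈-resp-↭ (shift (x , y) R E)) (run-acyclic run dominated′ acyclic′)
    where
    dominated′ : All (uncurry (Dominates (deleteCol α B))) ((x , y) ∷ R)
    dominated′ = step-dominates B α x y isStep
               ∷ All.map (Dominates-deleteCol {B = B} α) dominated

    acyclic′ : Acyclic ((x , y) ∷ R)
    acyclic′ = acyclic-∷ acyclic (step-¬dominates B α x y isStep ∘ Star⇒Dominates dominated)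

lemma3p5 : ∀ (m n : ℕ) (A : Mat m n) → InAvoid A → suc m < n →
    ∀ (E : List (Edge m)) → ProcedureGraph A E → Acyclic E
lemma3p5 m n A _ _ E run = run-acyclic run [] acyclic-[]
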